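{- Let $\mathbb{F}_q$ be a finite field, $N\ge2$ and $d\ge0$. Then $$\mathcal{F}^{(1,N,N+1)}_{d,4}(\mathbb{F}_q)=\{f_1f_2^2f_3^3 : f_1,f_2,f_3\in\mathbb{F}_q[x] \text{ monic square-free, pairwise coprime},\ \deg f_1+N\deg f_2+(N+1)\deg f_3=d\}$$ $$=\{\tilde f_1\tilde f_2^2 : \tilde f_1,\tilde f_2\in\mathbb{F}_q[x]\text{ monic square-free},\ \deg\tilde f_1+N\deg\tilde f_2=d\}.$$
   Context: Every nonzero 4th-power-free polynomial $f\in\mathbb{F}_q[x]$ has a unique decomposition $f=af_1f_2^2f_3^3$ with $a\in\mathbb{F}_q^\times$ and $f_1,f_2,f_3$ monic, square-free and pairwise coprime. $\mathcal{F}^{(1,N,N+1)}_{d,4}(\mathbb{F}_q)$ denotes the set of monic 4th-power-free $f=f_1f_2^2f_3^3$ with $\deg f_1+N\deg f_2+(N+1)\deg f_3=d$. In the second set, $\tilde f_1$ and $\tilde f_2$ need not be coprime. -}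

module Defs where

open import Level using (0ℓ)
open import Data.Nat using (ℕ; zero; suc; _∸_) renaming (_+_ to _+ℕ_; _*_ to _*ℕ_)
open import Data.List using (List; []; _∷_; length; map; last)
open import Data.List.Membership.Propositional using (_∈_)
open import Data.Maybe using (Maybe; just)
open import Data.Product using (Σ; ∃; _×_; _,_)
open import Relation.Nullary using (¬_; yes; no)
open import Relation.Binary.PropositionalEquality using (_≡_)
open import Relation.Binary.Definitions using (DecidableEquality)
open import Algebra.Core using (Op₁; Op₂)
open import Algebra.Structures using (IsCommutativeRing)

record FiniteField : Set₁ where
  field
    Carrier : Set
    _≟_     : DecidableEquality Carrier
    _+_ _*_ : Op₂ Carrier
    -_      : Op₁ Carrier
    0# 1#   : Carrier
    isCommutativeRing : IsCommutativeRing _≡_ _+_ _*_ -_ 0# 1#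
    0≢1     : ¬ (0# ≡ 1#)
    inverse : ∀ x → ¬ (x ≡ 0#) → ∃ λ y → x * y ≡ 1#
    elements : List Carrier
    complete : ∀ x → x ∈ elements

-- Univariate polynomials over F, represented by coefficient lists
-- (lowest degree first); trailing zeros are irrelevant (see _≈ₚ_).
module Poly (F : FiniteField) where
  open FiniteField F

  Pol : Set
  Pol = List Carrier

  private
    consNorm : Carrier → List Carrier → List Carrier
    consNorm a [] with a ≟ 0#
    ... | yes _ = []
    ... | no _  = a ∷ []
    consNorm a (b ∷ bs) = a ∷ b ∷ bs

  strip : Pol → Pol
  strip []       = []
  strip (a ∷ as) = consNorm a (strip as)

  _≈ₚ_ : Pol → Pol → Set
  p ≈ₚ q = strip p ≡ strip q

  addP : Pol → Pol → Pol
  addP []       q        = q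
  addP (a ∷ p)  []       = a ∷ p
  addP (a ∷ p)  (b ∷ q)  = (a + b) ∷ addP p q

  mulP : Pol → Pol → Pol
  mulP []      q = []
  mulP (a ∷ p) q = addP (map (a *_) q) (0# ∷ mulP p q)

  powP : Pol → ℕ → Pol
  powP p zero    = 1# ∷ []
  powP p (suc n) = mulP p (powP p n)

  -- degree (the zero polynomial gets degree 0; it never occurs below
  -- since all polynomials considered are monic or divide a monic one)
  deg : Pol → ℕ
  deg p = length (strip p) ∸ 1

  Monic : Pol → Set
  Monic p = last (strip p) ≡ just 1#

  _∣ₚ_ : Pol → Pol → Set
  g ∣ₚ f = ∃ λ h → mulP g h ≈ₚ f

  SquareFree : Pol → Set
  SquareFree f = ∀ g → powP g 2 ∣ₚ f → deg g ≡ 0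

  FourthPowerFree : Pol → Set
  FourthPowerFree f = ∀ g → powP g 4 ∣ₚ f → deg g ≡ 0

  Coprime : Pol → Pol → Set
  Coprime f g = ∀ h → h ∣ₚ f → h ∣ₚ g → deg h ≡ 0

  Decomp : ℕ → ℕ → Pol → Set
  Decomp N d f = Σ Pol λ f1 → Σ Pol λ f2 → Σ Pol λ f3 →
      Monic f1 × Monic f2 × Monic f3
    × SquareFree f1 × SquareFree f2 × SquareFree f3
    × Coprime f1 f2 × Coprime f1 f3 × Coprime f2 f3
    × (deg f1 +ℕ N *ℕ deg f2 +ℕ suc N *ℕ deg f3 ≡ d)
    × (f ≈ₚ mulP f1 (mulP (powP f2 2) (powP f3 3)))

  InF : ℕ → ℕ → Pol → Set
  InF N d f = Monic f × FourthPowerFree f × Decomp N d f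

  TwoFactor : ℕ → ℕ → Pol → Set
  TwoFactor N d f = Σ Pol λ g1 → Σ Pol λ g2 →
      Monic g1 × Monic g2 × SquareFree g1 × SquareFree g2
    × (deg g1 +ℕ N *ℕ deg g2 ≡ d)
    × (f ≈ₚ mulP g1 (powP g2 2))

module Submission where

-- Finiteness of F makes divisibility decidable and lets us
-- enumerate all polynomials of bounded degree; this gives an irreducible
-- factor of every nonconstant polynomial, Euclid's lemma for irreducibles,
-- and a common divisor of maximal degree of two polynomials (via the
-- general `maximum` search proved first).  Then:
--   (ii) ⇒ (i)   an irreducible p with p⁴ ∣ f₁ f₂² f₃³ divides exactly one
--                fᵢ, so p^(i+1) ∣ fᵢⁱ, contradicting square-freeness of fᵢ;
--   (ii) ⇒ (iii) take g₁ = f₁ f₃ and g₂ = f₂ f₃ (a product of coprime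
--                square-free polynomials is square-free);
--   (iii) ⇒ (ii) take f₃ = a monic common divisor of g₁, g₂ of maximal
--                degree and fᵢ = gᵢ / f₃, which are then coprime.
-- The degrees match by (a + c) + N (b + c) = a + N b + (N + 1) c.

open import Defs
open import Data.Nat using (ℕ; _≤_)
open import Data.Product using (_×_)
open import Function.Bundles using (_⇔_)

open import Level using (0ℓ)
open import Data.Nat using (zero; suc; z≤n; s≤s; _<_; _∸_) renaming (_+_ to _+ℕ_; _*_ to _*ℕ_)
import Data.Nat.Properties as ℕ
open import Data.Nat.Solver using (module +-*-Solver)
open import Relation.Binary.Definitions using (tri<; tri≈; tri>)
open import Data.List using (List; []; _∷_; length; map; last; cartesianProductWith)
open import Data.List.Relation.Unary.Any using (here; there; any?)
open import Data.List.Membership.Propositional using (_∈_; find; lose)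
open import Data.List.Membership.Propositional.Properties using (∈-cartesianProductWith⁺)
open import Data.Maybe using (just)
open import Data.Maybe.Properties using (just-injective)
open import Data.Product using (Σ; _,_; proj₁; proj₂)
open import Data.Sum using (_⊎_; inj₁; inj₂)
open import Data.Empty using (⊥; ⊥-elim)
open import Relation.Nullary using (¬_; yes; no; Dec)
open import Data.Nat.Induction using (<-rec)
open import Relation.Binary.PropositionalEquality
open import Relation.Binary.Bundles using (Setoid)
import Relation.Binary.Reasoning.Setoid
open import Algebra.Bundles using (CommutativeRing; CommutativeMonoid)
import Algebra.Solver.CommutativeMonoid as CommutativeMonoidSolver
open import Function.Bundles using (mk⇔)

-- Weighted degree of f₁ f₂² f₃³ equals that of (f₁ f₃)(f₂ f₃)².
weighted-degree-merge : ∀ a b c n → (a +ℕ c) +ℕ n *ℕ (b +ℕ c) ≡ a +ℕ n *ℕ b +ℕ suc n *ℕ c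
weighted-degree-merge = solve 4 (λ a b c n → (a :+ c) :+ n :* (b :+ c) := a :+ n :* b :+ (con 1 :+ n) :* c) refl
  where open +-*-Solver


record Maximum {A : Set} (μ : A → ℕ) (P : A → Set) (xs : List A) (x₀ : A) : Set where
  field
    best    : A
    holds   : P best
    ≥start  : μ x₀ ≤ μ best
    ≥listed : ∀ y → y ∈ xs → P y → μ y ≤ μ best

Maximum-cons : ∀ {A : Set} {μ : A → ℕ} {P : A → Set} {xs x₀ z} →
               Maximum μ P xs x₀ → (P z → μ z ≤ μ x₀) → Maximum μ P (z ∷ xs) x₀
Maximum-cons m z≤x₀ = record
  { best = best ; holds = holds ; ≥start = ≥start
  ; ≥listed = λ { y (here refl) py → ℕ.≤-trans (z≤x₀ py) ≥start ; y (there y∈xs) py → ≥listed y y∈xs py } }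
  where open Maximum m

maximum : ∀ {A : Set} (μ : A → ℕ) {P : A → Set} → (∀ x → Dec (P x)) →
          ∀ xs x₀ → P x₀ → Maximum μ P xs x₀
maximum μ P? [] x₀ px₀ = record { best = x₀ ; holds = px₀ ; ≥start = ℕ.≤-refl ; ≥listed = λ _ () }
maximum μ P? (z ∷ zs) x₀ px₀ with P? z
... | no ¬pz = Maximum-cons (maximum μ P? zs x₀ px₀) (λ pz → ⊥-elim (¬pz pz))
... | yes pz with μ x₀ ℕ.≤? μ z
...   | no x₀≰z  = Maximum-cons (maximum μ P? zs x₀ px₀) (λ _ → ℕ.<⇒≤ (ℕ.≰⇒> x₀≰z))
...   | yes x₀≤z = record { best = best ; holds = holds ; ≥start = ℕ.≤-trans x₀≤z ≥start
                          ; ≥listed = ≥listed }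
  where open Maximum (Maximum-cons (maximum μ P? zs z pz) (λ _ → ℕ.≤-refl))

module Polynomials (F : FiniteField) where
  open FiniteField F renaming (_+_ to infixl 6 _+_; _*_ to infixl 7 _*_; -_ to infix 8 -_)
  open Poly F

  fieldRing : CommutativeRing 0ℓ 0ℓ
  fieldRing = record { isCommutativeRing = isCommutativeRing }

  open CommutativeRing fieldRing
    using (+-assoc; +-comm; +-identityˡ; +-identityʳ; *-assoc; *-comm; *-identityˡ; *-identityʳ;
           distribˡ; distribʳ; zeroˡ; zeroʳ; -‿inverseʳ; -‿inverseˡ)
  open import Algebra.Properties.Ring (CommutativeRing.ring fieldRing)
    using (-0#≈0#; -‿distribʳ-*; -‿+-comm; x∙y⁻¹≈ε⇒x≈y; xyx⁻¹≈y)
  open import Algebra.Properties.CommutativeSemigroup (CommutativeRing.+-commutativeSemigroup fieldRing)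
    using (x∙yz≈y∙xz; interchange)

  no-zero-divisors : ∀ a b → a * b ≡ 0# → ¬ a ≡ 0# → b ≡ 0#
  no-zero-divisors a b ab≡0 a≢0 with inverse a a≢0
  ... | a⁻¹ , aa⁻¹≡1 = begin
    b             ≡⟨ sym (*-identityˡ b) ⟩
    1# * b        ≡⟨ cong (_* b) (trans (sym aa⁻¹≡1) (*-comm a a⁻¹)) ⟩
    a⁻¹ * a * b   ≡⟨ *-assoc a⁻¹ a b ⟩
    a⁻¹ * (a * b) ≡⟨ cong (a⁻¹ *_) ab≡0 ⟩
    a⁻¹ * 0#      ≡⟨ zeroʳ a⁻¹ ⟩
    0#            ∎
    where open ≡-Reasoning

  *-nonzero : ∀ {a b} → ¬ a ≡ 0# → ¬ b ≡ 0# → ¬ a * b ≡ 0#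
  *-nonzero {a} {b} a≢0 b≢0 ab≡0 = b≢0 (no-zero-divisors a b ab≡0 a≢0)

  inverse-nonzero : ∀ {e e⁻¹} → e * e⁻¹ ≡ 1# → ¬ e⁻¹ ≡ 0#
  inverse-nonzero {e} ee⁻¹≡1 e⁻¹≡0 = 0≢1 (trans (sym (zeroʳ e)) (trans (cong (e *_) (sym e⁻¹≡0)) ee⁻¹≡1))

  coeff : Pol → ℕ → Carrier
  coeff []      i       = 0#
  coeff (a ∷ p) zero    = a
  coeff (a ∷ p) (suc i) = coeff p i

  infix 4 _≋_
  record _≋_ (p q : Pol) : Set where
    constructor mk≋
    field get : ∀ i → coeff p i ≡ coeff q i
  open _≋_ public

  ≋-refl : ∀ {p} → p ≋ p
  ≋-refl = mk≋ λ i → refl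

  ≋-sym : ∀ {p q} → p ≋ q → q ≋ p
  ≋-sym (mk≋ e) = mk≋ λ i → sym (e i)

  ≋-trans : ∀ {p q r} → p ≋ q → q ≋ r → p ≋ r
  ≋-trans (mk≋ e) (mk≋ e′) = mk≋ λ i → trans (e i) (e′ i)

  ≋-setoid : Setoid 0ℓ 0ℓ
  ≋-setoid = record
    { Carrier = Pol ; _≈_ = _≋_
    ; isEquivalence = record { refl = ≋-refl ; sym = ≋-sym ; trans = ≋-trans } }

  Zero : Pol → Set
  Zero p = p ≋ []

  cons-cong : ∀ {a b p q} → a ≡ b → p ≋ q → (a ∷ p) ≋ (b ∷ q)
  cons-cong e (mk≋ e′) = mk≋ λ { zero → e ; (suc i) → e′ i }

  tail-≋ : ∀ {a b p q} → (a ∷ p) ≋ (b ∷ q) → p ≋ q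
  tail-≋ (mk≋ e) = mk≋ λ i → e (suc i)

  zero-cons : ∀ {a p} → a ≡ 0# → Zero p → Zero (a ∷ p)
  zero-cons a≡0 (mk≋ z) = mk≋ λ { zero → a≡0 ; (suc i) → z i }

  zero-tail : ∀ {a p} → Zero (a ∷ p) → Zero p
  zero-tail (mk≋ e) = mk≋ λ i → e (suc i)

  coeff-strip : ∀ p i → coeff (strip p) i ≡ coeff p i
  coeff-strip []      i = refl
  coeff-strip (a ∷ p) i with strip p | coeff-strip p
  ... | b ∷ bs | ih = tail-case i
    where
    tail-case : ∀ i → coeff (a ∷ b ∷ bs) i ≡ coeff (a ∷ p) i
    tail-case zero    = refl
    tail-case (suc i) = ih i
  ... | [] | ih with a ≟ 0#
  ...   | yes a≡0 = zero-case i
    where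
    zero-case : ∀ i → 0# ≡ coeff (a ∷ p) i
    zero-case zero    = sym a≡0
    zero-case (suc i) = ih i
  ...   | no _ = const-case i
    where
    const-case : ∀ i → coeff (a ∷ []) i ≡ coeff (a ∷ p) i
    const-case zero    = refl
    const-case (suc i) = ih i

  strip-zero : ∀ {p} → Zero p → strip p ≡ []
  strip-zero {[]}    z = refl
  strip-zero {a ∷ p} z rewrite strip-zero (zero-tail z) | get z 0 with 0# ≟ 0#
  ... | yes _   = refl
  ... | no 0≢0 = ⊥-elim (0≢0 refl)

  strip-cong : ∀ {p q} → p ≋ q → strip p ≡ strip q
  strip-cong {[]}    {[]}    e = refl
  strip-cong {[]}    {b ∷ q} e = sym (strip-zero (≋-sym e))
  strip-cong {a ∷ p} {[]}    e = strip-zero e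
  strip-cong {a ∷ p} {b ∷ q} e rewrite get e 0 | strip-cong (tail-≋ e) = refl

  strip-≋ : ∀ p → strip p ≋ p
  strip-≋ p = mk≋ (coeff-strip p)

  ≈ₚ⇒≋ : ∀ {p q} → p ≈ₚ q → p ≋ q
  ≈ₚ⇒≋ {p} {q} e = ≋-trans (≋-sym (strip-≋ p)) (≋-trans (mk≋ λ i → cong (λ s → coeff s i) e) (strip-≋ q))

  ≋⇒≈ₚ : ∀ {p q} → p ≋ q → p ≈ₚ q
  ≋⇒≈ₚ = strip-cong

  scale : Carrier → Pol → Pol
  scale a = map (a *_)

  negP : Pol → Pol
  negP = map -_

  subP : Pol → Pol → Pol
  subP p q = addP p (negP q)

  coeff-add : ∀ p q i → coeff (addP p q) i ≡ coeff p i + coeff q i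
  coeff-add []      q       i       = sym (+-identityˡ _)
  coeff-add (a ∷ p) []      i       = sym (+-identityʳ _)
  coeff-add (a ∷ p) (b ∷ q) zero    = refl
  coeff-add (a ∷ p) (b ∷ q) (suc i) = coeff-add p q i

  coeff-scale : ∀ a q i → coeff (scale a q) i ≡ a * coeff q i
  coeff-scale a []      i       = sym (zeroʳ a)
  coeff-scale a (b ∷ q) zero    = refl
  coeff-scale a (b ∷ q) (suc i) = coeff-scale a q i

  coeff-neg : ∀ q i → coeff (negP q) i ≡ - coeff q i
  coeff-neg []      i       = sym -0#≈0#
  coeff-neg (b ∷ q) zero    = refl
  coeff-neg (b ∷ q) (suc i) = coeff-neg q i

  coeff-sub : ∀ p q i → coeff (subP p q) i ≡ coeff p i + - coeff q i
  coeff-sub p q i = trans (coeff-add p (negP q) i) (cong (coeff p i +_) (coeff-neg q i))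

  add-cong : ∀ {p p′ q q′} → p ≋ p′ → q ≋ q′ → addP p q ≋ addP p′ q′
  add-cong {p} {p′} {q} {q′} (mk≋ e) (mk≋ e′) = mk≋ λ i →
    trans (coeff-add p q i) (trans (cong₂ _+_ (e i) (e′ i)) (sym (coeff-add p′ q′ i)))

  scale-cong : ∀ {a b p q} → a ≡ b → p ≋ q → scale a p ≋ scale b q
  scale-cong {a} {b} {p} {q} e (mk≋ e′) = mk≋ λ i →
    trans (coeff-scale a p i) (trans (cong₂ _*_ e (e′ i)) (sym (coeff-scale b q i)))

  neg-cong : ∀ {p q} → p ≋ q → negP p ≋ negP q
  neg-cong {p} {q} (mk≋ e) = mk≋ λ i → trans (coeff-neg p i) (trans (cong -_ (e i)) (sym (coeff-neg q i)))

  sub-cong : ∀ {p p′ q q′} → p ≋ p′ → q ≋ q′ → subP p q ≋ subP p′ q′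
  sub-cong e e′ = add-cong e (neg-cong e′)

  add-comm : ∀ p q → addP p q ≋ addP q p
  add-comm p q = mk≋ λ i → trans (coeff-add p q i) (trans (+-comm _ _) (sym (coeff-add q p i)))

  add-assoc : ∀ p q r → addP (addP p q) r ≋ addP p (addP q r)
  add-assoc p q r = mk≋ λ i → begin
    coeff (addP (addP p q) r) i          ≡⟨ coeff-add (addP p q) r i ⟩
    coeff (addP p q) i + coeff r i       ≡⟨ cong (_+ coeff r i) (coeff-add p q i) ⟩
    coeff p i + coeff q i + coeff r i    ≡⟨ +-assoc _ _ _ ⟩
    coeff p i + (coeff q i + coeff r i)  ≡⟨ cong (coeff p i +_) (coeff-add q r i) ⟨
    coeff p i + coeff (addP q r) i       ≡⟨ coeff-add p (addP q r) i ⟨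
    coeff (addP p (addP q r)) i          ∎
    where open ≡-Reasoning

  add-zeroʳ : ∀ {p q} → Zero q → addP p q ≋ p
  add-zeroʳ {p} {q} (mk≋ z) = mk≋ λ i → trans (coeff-add p q i) (trans (cong (coeff p i +_) (z i)) (+-identityʳ _))

  add-zeroˡ : ∀ {p q} → Zero p → addP p q ≋ q
  add-zeroˡ {p} {q} (mk≋ z) = mk≋ λ i → trans (coeff-add p q i) (trans (cong (_+ coeff q i) (z i)) (+-identityˡ _))

  add-swap : ∀ p q r → addP p (addP q r) ≋ addP q (addP p r)
  add-swap p q r = mk≋ λ i → begin
    coeff (addP p (addP q r)) i          ≡⟨ coeff-add p (addP q r) i ⟩
    coeff p i + coeff (addP q r) i       ≡⟨ cong (coeff p i +_) (coeff-add q r i) ⟩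
    coeff p i + (coeff q i + coeff r i)  ≡⟨ x∙yz≈y∙xz _ _ _ ⟩
    coeff q i + (coeff p i + coeff r i)  ≡⟨ cong (coeff q i +_) (coeff-add p r i) ⟨
    coeff q i + coeff (addP p r) i       ≡⟨ coeff-add q (addP p r) i ⟨
    coeff (addP q (addP p r)) i          ∎
    where open ≡-Reasoning

  add-interchange : ∀ a b c d → addP (addP a b) (addP c d) ≋ addP (addP a c) (addP b d)
  add-interchange a b c d = mk≋ λ i → begin
    coeff (addP (addP a b) (addP c d)) i                ≡⟨ coeff-add (addP a b) (addP c d) i ⟩
    coeff (addP a b) i + coeff (addP c d) i             ≡⟨ cong₂ _+_ (coeff-add a b i) (coeff-add c d i) ⟩
    (coeff a i + coeff b i) + (coeff c i + coeff d i)   ≡⟨ interchange _ _ _ _ ⟩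
    (coeff a i + coeff c i) + (coeff b i + coeff d i)   ≡⟨ cong₂ _+_ (coeff-add a c i) (coeff-add b d i) ⟨
    coeff (addP a c) i + coeff (addP b d) i             ≡⟨ coeff-add (addP a c) (addP b d) i ⟨
    coeff (addP (addP a c) (addP b d)) i                ∎
    where open ≡-Reasoning

  scale-add : ∀ a p q → scale a (addP p q) ≋ addP (scale a p) (scale a q)
  scale-add a p q = mk≋ λ i → begin
    coeff (scale a (addP p q)) i                ≡⟨ coeff-scale a (addP p q) i ⟩
    a * coeff (addP p q) i                      ≡⟨ cong (a *_) (coeff-add p q i) ⟩
    a * (coeff p i + coeff q i)                 ≡⟨ distribˡ a _ _ ⟩
    a * coeff p i + a * coeff q i               ≡⟨ cong₂ _+_ (coeff-scale a p i) (coeff-scale a q i) ⟨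
    coeff (scale a p) i + coeff (scale a q) i   ≡⟨ coeff-add (scale a p) (scale a q) i ⟨
    coeff (addP (scale a p) (scale a q)) i      ∎
    where open ≡-Reasoning

  add-scale : ∀ a b p → scale (a + b) p ≋ addP (scale a p) (scale b p)
  add-scale a b p = mk≋ λ i → begin
    coeff (scale (a + b) p) i                   ≡⟨ coeff-scale (a + b) p i ⟩
    (a + b) * coeff p i                         ≡⟨ distribʳ (coeff p i) a b ⟩
    a * coeff p i + b * coeff p i               ≡⟨ cong₂ _+_ (coeff-scale a p i) (coeff-scale b p i) ⟨
    coeff (scale a p) i + coeff (scale b p) i   ≡⟨ coeff-add (scale a p) (scale b p) i ⟨
    coeff (addP (scale a p) (scale b p)) i      ∎
    where open ≡-Reasoning

  scale-scale : ∀ a b p → scale (a * b) p ≋ scale a (scale b p)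
  scale-scale a b p = mk≋ λ i → begin
    coeff (scale (a * b) p) i       ≡⟨ coeff-scale (a * b) p i ⟩
    a * b * coeff p i               ≡⟨ *-assoc a b _ ⟩
    a * (b * coeff p i)             ≡⟨ cong (a *_) (coeff-scale b p i) ⟨
    a * coeff (scale b p) i         ≡⟨ coeff-scale a (scale b p) i ⟨
    coeff (scale a (scale b p)) i   ∎
    where open ≡-Reasoning

  scale-one : ∀ p → scale 1# p ≋ p
  scale-one p = mk≋ λ i → trans (coeff-scale 1# p i) (*-identityˡ _)

  scale-zero : ∀ p → Zero (scale 0# p)
  scale-zero p = mk≋ λ i → trans (coeff-scale 0# p i) (zeroˡ _)

  neg-add : ∀ p q → negP (addP p q) ≋ addP (negP p) (negP q)
  neg-add p q = mk≋ λ i → begin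
    coeff (negP (addP p q)) i                 ≡⟨ coeff-neg (addP p q) i ⟩
    - coeff (addP p q) i                      ≡⟨ cong -_ (coeff-add p q i) ⟩
    - (coeff p i + coeff q i)                 ≡⟨ -‿+-comm _ _ ⟨
    - coeff p i + - coeff q i                 ≡⟨ cong₂ _+_ (coeff-neg p i) (coeff-neg q i) ⟨
    coeff (negP p) i + coeff (negP q) i       ≡⟨ coeff-add (negP p) (negP q) i ⟨
    coeff (addP (negP p) (negP q)) i          ∎
    where open ≡-Reasoning

  scale-neg : ∀ a p → scale a (negP p) ≋ negP (scale a p)
  scale-neg a p = mk≋ λ i → begin
    coeff (scale a (negP p)) i    ≡⟨ coeff-scale a (negP p) i ⟩
    a * coeff (negP p) i          ≡⟨ cong (a *_) (coeff-neg p i) ⟩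
    a * - coeff p i               ≡⟨ -‿distribʳ-* a _ ⟨
    - (a * coeff p i)             ≡⟨ cong -_ (coeff-scale a p i) ⟨
    - coeff (scale a p) i         ≡⟨ coeff-neg (scale a p) i ⟨
    coeff (negP (scale a p)) i    ∎
    where open ≡-Reasoning

  sub-self : ∀ {p q} → p ≋ q → Zero (subP p q)
  sub-self {p} {q} (mk≋ e) = mk≋ λ i → trans (coeff-sub p q i) (trans (cong (_+ - coeff q i) (e i)) (-‿inverseʳ _))

  sub-zero : ∀ {p q} → Zero (subP p q) → p ≋ q
  sub-zero {p} {q} (mk≋ z) = mk≋ λ i → x∙y⁻¹≈ε⇒x≈y _ _ (trans (sym (coeff-sub p q i)) (z i))

  sub-add : ∀ a t → a ≋ addP (subP a t) t
  sub-add a t = mk≋ λ i → sym (begin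
    coeff (addP (subP a t) t) i             ≡⟨ coeff-add (subP a t) t i ⟩
    coeff (subP a t) i + coeff t i          ≡⟨ cong (_+ coeff t i) (coeff-sub a t i) ⟩
    coeff a i + - coeff t i + coeff t i     ≡⟨ +-assoc _ _ _ ⟩
    coeff a i + (- coeff t i + coeff t i)   ≡⟨ cong (coeff a i +_) (-‿inverseˡ _) ⟩
    coeff a i + 0#                          ≡⟨ +-identityʳ _ ⟩
    coeff a i                               ∎)
    where open ≡-Reasoning

  add-sub : ∀ {f x r} → f ≋ addP x r → subP f x ≋ r
  add-sub {f} {x} {r} (mk≋ e) = mk≋ λ i → begin
    coeff (subP f x) i                         ≡⟨ coeff-sub f x i ⟩
    coeff f i + - coeff x i                    ≡⟨ cong (_+ - coeff x i) (trans (e i) (coeff-add x r i)) ⟩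
    coeff x i + coeff r i + - coeff x i        ≡⟨ xyx⁻¹≈y (coeff x i) (coeff r i) ⟩
    coeff r i                                  ∎
    where open ≡-Reasoning

  module ≋-Reasoning = Relation.Binary.Reasoning.Setoid ≋-setoid

  mul-zeroˡ : ∀ {p} q → Zero p → Zero (mulP p q)
  mul-zeroˡ {[]}    q z = ≋-refl
  mul-zeroˡ {a ∷ p} q z =
    add-cong (≋-trans (scale-cong (get z 0) ≋-refl) (scale-zero q)) (zero-cons refl (mul-zeroˡ q (zero-tail z)))

  mul-congˡ : ∀ {p p′} q → p ≋ p′ → mulP p q ≋ mulP p′ q
  mul-congˡ {[]}    {[]}     q e = ≋-refl
  mul-congˡ {[]}    {b ∷ p′} q e = ≋-sym (mul-zeroˡ q (≋-sym e))
  mul-congˡ {a ∷ p} {[]}     q e = mul-zeroˡ q e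
  mul-congˡ {a ∷ p} {b ∷ p′} q e = add-cong (scale-cong (get e 0) ≋-refl) (cons-cong refl (mul-congˡ q (tail-≋ e)))

  mul-congʳ : ∀ p {q q′} → q ≋ q′ → mulP p q ≋ mulP p q′
  mul-congʳ []      e = ≋-refl
  mul-congʳ (a ∷ p) e = add-cong (scale-cong refl e) (cons-cong refl (mul-congʳ p e))

  mul-cong : ∀ {p p′ q q′} → p ≋ p′ → q ≋ q′ → mulP p q ≋ mulP p′ q′
  mul-cong {p} {p′} {q} e e′ = ≋-trans (mul-congˡ q e) (mul-congʳ p′ e′)

  mul-nilʳ : ∀ p → Zero (mulP p [])
  mul-nilʳ []      = ≋-refl
  mul-nilʳ (a ∷ p) = zero-cons refl (mul-nilʳ p)

  mul-zeroʳ : ∀ p {q} → Zero q → Zero (mulP p q)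
  mul-zeroʳ p z = ≋-trans (mul-congʳ p z) (mul-nilʳ p)

  mul-constˡ : ∀ s q → mulP (s ∷ []) q ≋ scale s q
  mul-constˡ s q = add-zeroʳ (zero-cons refl ≋-refl)

  mul-oneˡ : ∀ q → mulP (1# ∷ []) q ≋ q
  mul-oneˡ q = ≋-trans (mul-constˡ 1# q) (scale-one q)

  mul-shiftˡ : ∀ p q → mulP (0# ∷ p) q ≋ (0# ∷ mulP p q)
  mul-shiftˡ p q = add-zeroˡ (scale-zero q)

  mul-scaleˡ : ∀ s p q → mulP (scale s p) q ≋ scale s (mulP p q)
  mul-scaleˡ s []      q = ≋-refl
  mul-scaleˡ s (a ∷ p) q =
    ≋-trans (add-cong (scale-scale s a q) (cons-cong (sym (zeroʳ s)) (mul-scaleˡ s p q)))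
            (≋-sym (scale-add s (scale a q) (0# ∷ mulP p q)))

  mul-distribʳ : ∀ p q r → mulP (addP p q) r ≋ addP (mulP p r) (mulP q r)
  mul-distribʳ []      q       r = ≋-refl
  mul-distribʳ (a ∷ p) []      r = ≋-sym (add-zeroʳ ≋-refl)
  mul-distribʳ (a ∷ p) (b ∷ q) r = begin
    addP (scale (a + b) r) (0# ∷ mulP (addP p q) r)
      ≈⟨ add-cong (add-scale a b r) (cons-cong (sym (+-identityˡ 0#)) (mul-distribʳ p q r)) ⟩
    addP (addP (scale a r) (scale b r)) (addP (0# ∷ mulP p r) (0# ∷ mulP q r))
      ≈⟨ add-interchange (scale a r) (scale b r) (0# ∷ mulP p r) (0# ∷ mulP q r) ⟩
    addP (mulP (a ∷ p) r) (mulP (b ∷ q) r)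
      ∎
    where open ≋-Reasoning

  mul-distribˡ : ∀ p q r → mulP p (addP q r) ≋ addP (mulP p q) (mulP p r)
  mul-distribˡ []      q r = ≋-refl
  mul-distribˡ (a ∷ p) q r = begin
    addP (scale a (addP q r)) (0# ∷ mulP p (addP q r))
      ≈⟨ add-cong (scale-add a q r) (cons-cong (sym (+-identityˡ 0#)) (mul-distribˡ p q r)) ⟩
    addP (addP (scale a q) (scale a r)) (addP (0# ∷ mulP p q) (0# ∷ mulP p r))
      ≈⟨ add-interchange (scale a q) (scale a r) (0# ∷ mulP p q) (0# ∷ mulP p r) ⟩
    addP (mulP (a ∷ p) q) (mulP (a ∷ p) r)
      ∎
    where open ≋-Reasoning

  mul-consʳ : ∀ q a p → mulP q (a ∷ p) ≋ addP (scale a q) (0# ∷ mulP q p)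
  mul-consʳ []      a p = ≋-sym (zero-cons refl ≋-refl)
  mul-consʳ (b ∷ q) a p = cons-cong (cong (_+ 0#) (*-comm b a))
    (≋-trans (add-cong ≋-refl (mul-consʳ q a p)) (add-swap (scale b p) (scale a q) (0# ∷ mulP q p)))

  mul-comm : ∀ p q → mulP p q ≋ mulP q p
  mul-comm []      q = ≋-sym (mul-nilʳ q)
  mul-comm (a ∷ p) q = ≋-trans (add-cong ≋-refl (cons-cong refl (mul-comm p q))) (≋-sym (mul-consʳ q a p))

  mul-assoc : ∀ p q r → mulP (mulP p q) r ≋ mulP p (mulP q r)
  mul-assoc []      q r = ≋-refl
  mul-assoc (a ∷ p) q r = begin
    mulP (addP (scale a q) (0# ∷ mulP p q)) r             ≈⟨ mul-distribʳ (scale a q) (0# ∷ mulP p q) r ⟩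
    addP (mulP (scale a q) r) (mulP (0# ∷ mulP p q) r)    ≈⟨ add-cong (mul-scaleˡ a q r) (mul-shiftˡ (mulP p q) r) ⟩
    addP (scale a (mulP q r)) (0# ∷ mulP (mulP p q) r)    ≈⟨ add-cong ≋-refl (cons-cong refl (mul-assoc p q r)) ⟩
    mulP (a ∷ p) (mulP q r)                               ∎
    where open ≋-Reasoning

  mul-oneʳ : ∀ q → mulP q (1# ∷ []) ≋ q
  mul-oneʳ q = ≋-trans (mul-comm q _) (mul-oneˡ q)

  mul-negʳ : ∀ p q → mulP p (negP q) ≋ negP (mulP p q)
  mul-negʳ []      q = ≋-refl
  mul-negʳ (a ∷ p) q = ≋-trans (add-cong (scale-neg a q) (cons-cong (sym -0#≈0#) (mul-negʳ p q)))
                               (≋-sym (neg-add (scale a q) (0# ∷ mulP p q)))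

  mul-subʳ : ∀ p q r → mulP p (subP q r) ≋ subP (mulP p q) (mulP p r)
  mul-subʳ p q r = ≋-trans (mul-distribˡ p q (negP r)) (add-cong ≋-refl (mul-negʳ p r))

  mul-subˡ : ∀ p q r → mulP (subP q r) p ≋ subP (mulP q p) (mulP r p)
  mul-subˡ p q r = ≋-trans (mul-comm _ p) (≋-trans (mul-subʳ p q r) (sub-cong (mul-comm p q) (mul-comm p r)))

  polyMonoid : CommutativeMonoid 0ℓ 0ℓ
  polyMonoid = record
    { Carrier = Pol ; _≈_ = _≋_ ; _∙_ = mulP ; ε = 1# ∷ []
    ; isCommutativeMonoid = record
      { isMonoid = record
        { isSemigroup = record
          { isMagma = record { isEquivalence = Setoid.isEquivalence ≋-setoid ; ∙-cong = mul-cong }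
          ; assoc = mul-assoc }
        ; identity = mul-oneˡ , mul-oneʳ }
      ; comm = mul-comm } }

  open CommutativeMonoidSolver polyMonoid using (solve; _⊜_; _⊕_; id; Expr)

  -- Solver expressions for x¹, x², x³ (powP unfolds to exactly these).
  pow1ᵉ pow2ᵉ pow3ᵉ : ∀ {n} → Expr n → Expr n
  pow1ᵉ x = x ⊕ id
  pow2ᵉ x = x ⊕ pow1ᵉ x
  pow3ᵉ x = x ⊕ pow2ᵉ x

  mul-interchange : ∀ a b c d → mulP (mulP a b) (mulP c d) ≋ mulP (mulP a c) (mulP b d)
  mul-interchange = solve 4 (λ a b c d → (a ⊕ b) ⊕ (c ⊕ d) ⊜ (a ⊕ c) ⊕ (b ⊕ d)) ≋-refl

  mul-exchange : ∀ a b c → mulP (mulP a b) c ≋ mulP (mulP a c) b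
  mul-exchange = solve 3 (λ a b c → (a ⊕ b) ⊕ c ⊜ (a ⊕ c) ⊕ b) ≋-refl

  front₁ : ∀ a b c → mulP a (mulP (powP b 2) (powP c 3)) ≋ mulP (powP a 1) (mulP (powP b 2) (powP c 3))
  front₁ = solve 3 (λ a b c → a ⊕ (pow2ᵉ b ⊕ pow3ᵉ c) ⊜ pow1ᵉ a ⊕ (pow2ᵉ b ⊕ pow3ᵉ c)) ≋-refl

  front₂ : ∀ a b c → mulP a (mulP (powP b 2) (powP c 3)) ≋ mulP (powP b 2) (mulP (powP a 1) (powP c 3))
  front₂ = solve 3 (λ a b c → a ⊕ (pow2ᵉ b ⊕ pow3ᵉ c) ⊜ pow2ᵉ b ⊕ (pow1ᵉ a ⊕ pow3ᵉ c)) ≋-refl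

  front₃ : ∀ a b c → mulP a (mulP (powP b 2) (powP c 3)) ≋ mulP (powP c 3) (mulP (powP a 1) (powP b 2))
  front₃ = solve 3 (λ a b c → a ⊕ (pow2ᵉ b ⊕ pow3ᵉ c) ⊜ pow3ᵉ c ⊕ (pow1ᵉ a ⊕ pow2ᵉ b)) ≋-refl

  merge-cube : ∀ a b c → mulP a (mulP (powP b 2) (powP c 3)) ≋ mulP (mulP a c) (powP (mulP b c) 2)
  merge-cube = solve 3 (λ a b c → a ⊕ (pow2ᵉ b ⊕ pow3ᵉ c) ⊜ (a ⊕ c) ⊕ pow2ᵉ (b ⊕ c)) ≋-refl

  split-cube : ∀ t a b → mulP (mulP t a) (powP (mulP t b) 2) ≋ mulP a (mulP (powP b 2) (powP t 3))
  split-cube = solve 3 (λ t a b → (t ⊕ a) ⊕ pow2ᵉ (t ⊕ b) ⊜ a ⊕ (pow2ᵉ b ⊕ pow3ᵉ t)) ≋-refl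

  record Lead (p : Pol) (n : ℕ) (c : Carrier) : Set where
    constructor lead
    field
      at    : coeff p n ≡ c
      ≢0    : ¬ c ≡ 0#
      above : ∀ i → n < i → coeff p i ≡ 0#

  classify : ∀ p → Zero p ⊎ Σ ℕ λ n → Σ Carrier λ c → Lead p n c
  classify [] = inj₁ ≋-refl
  classify (a ∷ p) with classify p
  ... | inj₂ (n , c , lead at c≢0 above) = inj₂ (suc n , c , lead at c≢0 λ { zero () ; (suc i) (s≤s n<i) → above i n<i })
  ... | inj₁ z with a ≟ 0#
  ...   | yes a≡0 = inj₁ (zero-cons a≡0 z)
  ...   | no a≢0  = inj₂ (0 , a , lead refl a≢0 λ { zero () ; (suc i) _ → get z i })

  leading-term : ∀ {p} → ¬ Zero p → Σ ℕ λ n → Σ Carrier λ c → Lead p n c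
  leading-term {p} p≢0 with classify p
  ... | inj₁ z = ⊥-elim (p≢0 z)
  ... | inj₂ t = t

  zero? : ∀ p → Dec (Zero p)
  zero? p with classify p
  ... | inj₁ z = yes z
  ... | inj₂ (n , c , t) = no λ z → Lead.≢0 t (trans (sym (Lead.at t)) (get z n))

  Lead-≋ : ∀ {p q n c} → p ≋ q → Lead p n c → Lead q n c
  Lead-≋ {n = n} (mk≋ e) (lead at c≢0 above) = lead (trans (sym (e n)) at) c≢0 (λ i n<i → trans (sym (e i)) (above i n<i))

  Lead-unique : ∀ {p n m c e} → Lead p n c → Lead p m e → n ≡ m × c ≡ e
  Lead-unique {n = n} {m} (lead at c≢0 above) (lead at′ e≢0 above′) with ℕ.<-cmp n m
  ... | tri< n<m _ _ = ⊥-elim (e≢0 (trans (sym at′) (above m n<m)))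
  ... | tri> _ _ m<n = ⊥-elim (c≢0 (trans (sym at) (above′ n m<n)))
  ... | tri≈ _ refl _ = refl , trans (sym at) at′

  Lead-strip : ∀ {p n c} → Lead p n c → length (strip p) ≡ suc n × last (strip p) ≡ just c
  Lead-strip {[]} (lead at c≢0 _) = ⊥-elim (c≢0 (sym at))
  Lead-strip {a ∷ p} {zero} (lead at c≢0 above)
    rewrite strip-zero {p} (mk≋ λ i → above (suc i) (s≤s z≤n)) with a ≟ 0#
  ... | yes a≡0 = ⊥-elim (c≢0 (trans (sym at) a≡0))
  ... | no _    = refl , cong just at
  Lead-strip {a ∷ p} {suc n} {c} (lead at c≢0 above)
    with strip p | Lead-strip {p} {n} {c} (lead at c≢0 λ i n<i → above (suc i) (s≤s n<i))
  ... | b ∷ bs | len , lst = cong suc len , lst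

  -- sz p = deg p + 1 for p ≠ 0, and sz 0 = 0; it is the size that
  -- division with remainder decreases.
  sz : Pol → ℕ
  sz p = length (strip p)

  sz-Lead : ∀ {p n c} → Lead p n c → sz p ≡ suc n
  sz-Lead t = proj₁ (Lead-strip t)

  sz-zero : ∀ {p} → Zero p → sz p ≡ 0
  sz-zero z = cong length (strip-zero z)

  deg-Lead : ∀ {p n c} → Lead p n c → deg p ≡ n
  deg-Lead t = cong (_∸ 1) (sz-Lead t)

  deg-zero : ∀ {p} → Zero p → deg p ≡ 0
  deg-zero z = cong (_∸ 1) (sz-zero z)

  nonconstant-nonzero : ∀ {g} → 1 ≤ deg g → ¬ Zero g
  nonconstant-nonzero 1≤deg z with subst (1 ≤_) (deg-zero z) 1≤deg
  ... | ()

  deg-≋ : ∀ {p q} → p ≋ q → deg p ≡ deg q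
  deg-≋ e = cong (λ s → length s ∸ 1) (strip-cong e)

  sz-deg : ∀ {p} → ¬ Zero p → sz p ≡ suc (deg p)
  sz-deg p≢0 with leading-term p≢0
  ... | (n , c , t) = trans (sz-Lead t) (cong suc (sym (deg-Lead t)))

  sz-bound : ∀ {p} n → (∀ i → n ≤ i → coeff p i ≡ 0#) → sz p ≤ n
  sz-bound {p} n vanish with classify p
  ... | inj₁ z = subst (_≤ n) (sym (sz-zero z)) z≤n
  ... | inj₂ (k , c , t) with n ℕ.≤? k
  ...   | yes n≤k = ⊥-elim (Lead.≢0 t (trans (sym (Lead.at t)) (vanish k n≤k)))
  ...   | no n≰k  = subst (_≤ n) (sym (sz-Lead t)) (ℕ.≰⇒> n≰k)

  Lead-mul : ∀ {p q n m c e} → Lead p n c → Lead q m e → Lead (mulP p q) (n +ℕ m) (c * e)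
  Lead-mul {[]} (lead at c≢0 _) _ = ⊥-elim (c≢0 (sym at))
  Lead-mul {a ∷ p} {q} {zero} {m} {c} {e} (lead at c≢0 above) (lead at′ e≢0 above′) =
    lead (trans (coeff-mul m) (cong₂ _*_ at at′)) (*-nonzero c≢0 e≢0)
         (λ i m<i → trans (coeff-mul i) (trans (cong (a *_) (above′ i m<i)) (zeroʳ a)))
    where
    p≋0 : Zero p
    p≋0 = mk≋ λ i → above (suc i) (s≤s z≤n)
    coeff-mul : ∀ i → coeff (mulP (a ∷ p) q) i ≡ a * coeff q i
    coeff-mul i = trans (get (add-zeroʳ {scale a q} (zero-cons refl (mul-zeroˡ q p≋0))) i) (coeff-scale a q i)
  Lead-mul {a ∷ p} {q} {suc n} {m} {c} {e} (lead at c≢0 above) tq@(lead _ _ above′)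
    with Lead-mul {p} (lead at c≢0 λ i n<i → above (suc i) (s≤s n<i)) tq
  ... | lead at″ ce≢0 above″ =
    lead (shifted (suc (n +ℕ m)) (s≤s (ℕ.m≤n+m m n)) at″) ce≢0
         λ { zero () ; (suc i) (s≤s n+m<i) → shifted (suc i) (s≤s (ℕ.≤-trans (ℕ.m≤n+m m n) (ℕ.<⇒≤ n+m<i))) (above″ i n+m<i) }
    where
    shifted : ∀ i {x} → m < i → coeff (0# ∷ mulP p q) i ≡ x → coeff (mulP (a ∷ p) q) i ≡ x
    shifted i {x} m<i eq = begin
      coeff (mulP (a ∷ p) q) i                        ≡⟨ coeff-add (scale a q) (0# ∷ mulP p q) i ⟩
      coeff (scale a q) i + coeff (0# ∷ mulP p q) i   ≡⟨ cong₂ _+_ (coeff-scale a q i) eq ⟩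
      a * coeff q i + x                               ≡⟨ cong (λ y → a * y + x) (above′ i m<i) ⟩
      a * 0# + x                                      ≡⟨ cong (_+ x) (zeroʳ a) ⟩
      0# + x                                          ≡⟨ +-identityˡ x ⟩
      x                                               ∎
      where open ≡-Reasoning

  mul-nonzero : ∀ {p q} → ¬ Zero p → ¬ Zero q → ¬ Zero (mulP p q)
  mul-nonzero p≢0 q≢0 z with leading-term p≢0 | leading-term q≢0
  ... | (n , c , t) | (m , e , u) with Lead-mul t u
  ...   | lead at ce≢0 _ = ce≢0 (trans (sym at) (get z (n +ℕ m)))

  deg-mul : ∀ {p q} → ¬ Zero p → ¬ Zero q → deg (mulP p q) ≡ deg p +ℕ deg q
  deg-mul p≢0 q≢0 with leading-term p≢0 | leading-term q≢0
  ... | (n , c , t) | (m , e , u) = trans (deg-Lead (Lead-mul t u)) (sym (cong₂ _+ℕ_ (deg-Lead t) (deg-Lead u)))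

  mul-cancelˡ : ∀ {p a b} → ¬ Zero p → mulP p a ≋ mulP p b → a ≋ b
  mul-cancelˡ {p} {a} {b} p≢0 e with zero? (subP a b)
  ... | yes z = sub-zero z
  ... | no a-b≢0 = ⊥-elim (mul-nonzero p≢0 a-b≢0 (≋-trans (mul-subʳ p a b) (sub-self e)))

  Monic-≋ : ∀ {p q} → p ≋ q → Monic p → Monic q
  Monic-≋ e m = trans (cong last (sym (strip-cong e))) m

  Monic⇒Lead : ∀ {p} → Monic p → Σ ℕ λ n → Lead p n 1#
  Monic⇒Lead {p} m with classify p
  ... | inj₁ z rewrite strip-zero z with m
  ...   | ()
  Monic⇒Lead {p} m | inj₂ (n , c , t) = n , subst (Lead p n) (just-injective (trans (sym (proj₂ (Lead-strip t))) m)) t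

  Lead⇒Monic : ∀ {p n} → Lead p n 1# → Monic p
  Lead⇒Monic t = proj₂ (Lead-strip t)

  Monic-nonzero : ∀ {p} → Monic p → ¬ Zero p
  Monic-nonzero {p} m z with Monic⇒Lead {p} m
  ... | n , t = Lead.≢0 t (trans (sym (Lead.at t)) (get z n))

  Monic-mul : ∀ {p q} → Monic p → Monic q → Monic (mulP p q)
  Monic-mul {p} {q} mp mq with Monic⇒Lead {p} mp | Monic⇒Lead {q} mq
  ... | (n , t) | (m , u) = Lead⇒Monic {mulP p q} (subst (Lead _ _) (*-identityˡ 1#) (Lead-mul t u))

  one-Lead : Lead (1# ∷ []) 0 1#
  one-Lead = lead refl (λ 1≡0 → 0≢1 (sym 1≡0)) (λ { zero () ; (suc i) _ → refl })

  Monic-pow : ∀ {p} k → Monic p → Monic (powP p k)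
  Monic-pow zero    m = Lead⇒Monic {1# ∷ []} one-Lead
  Monic-pow {p} (suc k) m = Monic-mul {p} {powP p k} m (Monic-pow k m)

  Monic-cofactor : ∀ {t f g} → Monic t → Monic g → mulP t f ≋ g → Monic f
  Monic-cofactor {t} {f} {g} mt mg e with zero? f
  ... | yes z = ⊥-elim (Monic-nonzero {g} mg (≋-trans (≋-sym e) (mul-zeroʳ t z)))
  ... | no f≢0 with leading-term f≢0 | Monic⇒Lead {t} mt | Monic⇒Lead {g} mg
  ...   | (m , c , tf) | (n , tt) | (k , tg) = Lead⇒Monic {f} (subst (Lead f m) c≡1 tf)
    where
    c≡1 : c ≡ 1#
    c≡1 = trans (sym (*-identityˡ c)) (proj₂ (Lead-unique (Lead-≋ e (Lead-mul tt tf)) tg))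

  shiftBy : ℕ → Pol → Pol
  shiftBy zero    p = p
  shiftBy (suc k) p = 0# ∷ shiftBy k p

  Lead-shiftBy : ∀ k {p m e} → Lead p m e → Lead (shiftBy k p) (k +ℕ m) e
  Lead-shiftBy zero    t = t
  Lead-shiftBy (suc k) t with Lead-shiftBy k t
  ... | lead at e≢0 above = lead at e≢0 λ { zero () ; (suc i) (s≤s lt) → above i lt }

  shiftBy-scale : ∀ k s b → shiftBy k (scale s b) ≋ mulP (shiftBy k (s ∷ [])) b
  shiftBy-scale zero    s b = ≋-sym (mul-constˡ s b)
  shiftBy-scale (suc k) s b = ≋-trans (cons-cong refl (shiftBy-scale k s b)) (≋-sym (mul-shiftˡ (shiftBy k (s ∷ [])) b))

  Lead-scale : ∀ {p n c} s → ¬ s ≡ 0# → Lead p n c → Lead (scale s p) n (s * c)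
  Lead-scale {p} {n} s s≢0 (lead at c≢0 above) =
    lead (trans (coeff-scale s p n) (cong (s *_) at)) (*-nonzero s≢0 c≢0)
         (λ i lt → trans (coeff-scale s p i) (trans (cong (s *_) (above i lt)) (zeroʳ s)))

  -- One step of long division: if deg b ≤ deg a = n, subtracting a monomial
  -- multiple of b kills the coefficient of xⁿ, so a = (a - m b) + m b with
  -- a - m b vanishing from degree n on.
  record LeadingStep (a b : Pol) (n : ℕ) : Set where
    field
      monomial  : Pol
      remainder : Pol
      eqn       : a ≋ addP remainder (mulP monomial b)
      vanishes  : ∀ i → n ≤ i → coeff remainder i ≡ 0#

  leading-step : ∀ {a b n m c e} → Lead a n c → Lead b m e → m ≤ n → LeadingStep a b n
  leading-step {a} {b} {n} {m} {c} {e} ta tb m≤n = record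
    { monomial = shiftBy (n ∸ m) (s ∷ []) ; remainder = subP a T
    ; eqn = ≋-trans (sub-add a T) (add-cong ≋-refl (shiftBy-scale (n ∸ m) s b))
    ; vanishes = vanishes }
    where
    e⁻¹ = proj₁ (inverse e (Lead.≢0 tb))
    ee⁻¹≡1 : e * e⁻¹ ≡ 1#
    ee⁻¹≡1 = proj₂ (inverse e (Lead.≢0 tb))
    s = c * e⁻¹
    se≡c : s * e ≡ c
    se≡c = begin
      c * e⁻¹ * e   ≡⟨ *-assoc c e⁻¹ e ⟩
      c * (e⁻¹ * e) ≡⟨ cong (c *_) (trans (*-comm e⁻¹ e) ee⁻¹≡1) ⟩
      c * 1#        ≡⟨ *-identityʳ c ⟩
      c             ∎
      where open ≡-Reasoning
    T = shiftBy (n ∸ m) (scale s b)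
    tT : Lead T n c
    tT = subst₂ (Lead T) (ℕ.m∸n+n≡m m≤n) se≡c
           (Lead-shiftBy (n ∸ m) (Lead-scale s (*-nonzero (Lead.≢0 ta) (inverse-nonzero ee⁻¹≡1)) tb))
    vanishes : ∀ i → n ≤ i → coeff (subP a T) i ≡ 0#
    vanishes i n≤i with ℕ.m≤n⇒m<n∨m≡n n≤i
    ... | inj₁ n<i  = trans (coeff-sub a T i)
                        (trans (cong₂ (λ x y → x + - y) (Lead.above ta i n<i) (Lead.above tT i n<i)) (-‿inverseʳ 0#))
    ... | inj₂ refl = trans (coeff-sub a T n)
                        (trans (cong₂ (λ x y → x + - y) (Lead.at ta) (Lead.at tT)) (-‿inverseʳ c))

  record Division (a b : Pol) : Set where
    constructor division
    field
      quotient remainder : Pol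
      eqn   : a ≋ addP (mulP quotient b) remainder
      small : sz remainder < sz b

  divide : ∀ b → ¬ Zero b → ∀ a → Division a b
  divide b b≢0 a₀ with leading-term b≢0
  ... | (m , e , tb) = <-rec P step (sz a₀) a₀ refl
    where
    P : ℕ → Set
    P k = ∀ a → sz a ≡ k → Division a b
    step : ∀ k → (∀ {j} → j < k → P j) → P k
    step k ih a refl with classify a
    ... | inj₁ z = division [] a ≋-refl (subst₂ _<_ (sym (sz-zero z)) (sym (sz-Lead tb)) (s≤s z≤n))
    ... | inj₂ (n , c , ta) with n ℕ.<? m
    ...   | yes n<m = division [] a ≋-refl (subst₂ _<_ (sym (sz-Lead ta)) (sym (sz-Lead tb)) (s≤s n<m))
    ...   | no n≮m = division (addP q′ mono) r′ eqn small
      where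
      step₁ = leading-step ta tb (ℕ.≮⇒≥ n≮m)
      open LeadingStep step₁ using (vanishes) renaming (monomial to mono; remainder to a′)
      a′-smaller : sz a′ < sz a
      a′-smaller = subst (sz a′ <_) (sym (sz-Lead ta)) (s≤s (sz-bound {a′} n vanishes))
      open Division (ih a′-smaller a′ refl) using (small) renaming (quotient to q′; remainder to r′; eqn to eqn′)
      eqn : a ≋ addP (mulP (addP q′ mono) b) r′
      eqn = begin
        a                                              ≈⟨ LeadingStep.eqn step₁ ⟩
        addP a′ (mulP mono b)                          ≈⟨ add-cong eqn′ ≋-refl ⟩
        addP (addP (mulP q′ b) r′) (mulP mono b)       ≈⟨ add-assoc (mulP q′ b) r′ (mulP mono b) ⟩
        addP (mulP q′ b) (addP r′ (mulP mono b))       ≈⟨ add-cong (≋-refl {mulP q′ b}) (add-comm r′ (mulP mono b)) ⟩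
        addP (mulP q′ b) (addP (mulP mono b) r′)       ≈⟨ add-assoc (mulP q′ b) (mulP mono b) r′ ⟨
        addP (addP (mulP q′ b) (mulP mono b)) r′       ≈⟨ add-cong (mul-distribʳ q′ mono b) ≋-refl ⟨
        addP (mulP (addP q′ mono) b) r′                ∎
        where open ≋-Reasoning

  infix 4 _∣_
  record _∣_ (g f : Pol) : Set where
    constructor _,_
    field
      cofactor : Pol
      eqn      : mulP g cofactor ≋ f

  ∣ₚ⇒∣ : ∀ {g f} → g ∣ₚ f → g ∣ f
  ∣ₚ⇒∣ (h , e) = h , ≈ₚ⇒≋ e

  ∣⇒∣ₚ : ∀ {g f} → g ∣ f → g ∣ₚ f
  ∣⇒∣ₚ (h , e) = h , ≋⇒≈ₚ e

  ∣-refl : ∀ g → g ∣ g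
  ∣-refl g = (1# ∷ []) , mul-oneʳ g

  one-∣ : ∀ f → (1# ∷ []) ∣ f
  one-∣ f = f , mul-oneˡ f

  ∣-trans : ∀ {a b c} → a ∣ b → b ∣ c → a ∣ c
  ∣-trans {a} (h , e) (k , e′) = mulP h k , ≋-trans (≋-sym (mul-assoc a h k)) (≋-trans (mul-congˡ k e) e′)

  ∣-resp : ∀ {g g′ f f′} → g ≋ g′ → f ≋ f′ → g ∣ f → g′ ∣ f′
  ∣-resp g≋g′ f≋f′ (h , e) = h , ≋-trans (mul-congˡ h (≋-sym g≋g′)) (≋-trans e f≋f′)

  ∣-factorˡ : ∀ g k → g ∣ mulP g k
  ∣-factorˡ g k = k , ≋-refl

  ∣-factorʳ : ∀ g k → g ∣ mulP k g
  ∣-factorʳ g k = k , mul-comm g k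

  ∣-mulʳ : ∀ {g f} k → g ∣ f → g ∣ mulP f k
  ∣-mulʳ {g} k (h , e) = mulP h k , ≋-trans (≋-sym (mul-assoc g h k)) (mul-congˡ k e)

  ∣-mulˡ : ∀ {g f} k → g ∣ f → g ∣ mulP k f
  ∣-mulˡ {g} {f} k d = ∣-resp ≋-refl (mul-comm f k) (∣-mulʳ k d)

  ∣-mul : ∀ {a b c d} → a ∣ b → c ∣ d → mulP a c ∣ mulP b d
  ∣-mul {a} {b} {c} {d} (h , e) (k , e′) = mulP h k , ≋-trans (mul-interchange a c h k) (mul-cong e e′)

  ∣-add : ∀ {g a b} → g ∣ a → g ∣ b → g ∣ addP a b
  ∣-add {g} (h , e) (k , e′) = addP h k , ≋-trans (mul-distribˡ g h k) (add-cong e e′)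

  ∣-sub : ∀ {g a b} → g ∣ a → g ∣ b → g ∣ subP a b
  ∣-sub {g} (h , e) (k , e′) = subP h k , ≋-trans (mul-subʳ g h k) (sub-cong e e′)

  ∣-zero : ∀ g {z} → Zero z → g ∣ z
  ∣-zero g z = [] , ≋-trans (mul-nilʳ g) (≋-sym z)

  ∣-degrees : ∀ {g f} → ¬ Zero f → (d : g ∣ f) →
              ¬ Zero g × ¬ Zero (_∣_.cofactor d) × deg f ≡ deg g +ℕ deg (_∣_.cofactor d)
  ∣-degrees {g} {f} f≢0 (h , e) = g≢0 , h≢0 , trans (sym (deg-≋ e)) (deg-mul g≢0 h≢0)
    where
    g≢0 : ¬ Zero g
    g≢0 z = f≢0 (≋-trans (≋-sym e) (mul-zeroˡ h z))
    h≢0 : ¬ Zero h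
    h≢0 z = f≢0 (≋-trans (≋-sym e) (mul-zeroʳ g z))

  ∣-deg : ∀ {g f} → ¬ Zero f → g ∣ f → ¬ Zero g × deg g ≤ deg f
  ∣-deg {g} nf d with ∣-degrees nf d
  ... | g≢0 , _ , eq = g≢0 , subst (deg g ≤_) (sym eq) (ℕ.m≤m+n (deg g) _)

  ∣-sz : ∀ {g f} → ¬ Zero f → g ∣ f → sz g ≤ sz f
  ∣-sz nf d with ∣-deg nf d
  ... | g≢0 , le = subst₂ _≤_ (sym (sz-deg g≢0)) (sym (sz-deg nf)) (s≤s le)

  ∣-cancelˡ : ∀ {p a b} → ¬ Zero p → mulP p a ∣ mulP p b → a ∣ b
  ∣-cancelˡ {p} {a} p≢0 (h , e) = h , mul-cancelˡ p≢0 (≋-trans (≋-sym (mul-assoc p a h)) e)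

  ∣? : ∀ g → ¬ Zero g → ∀ f → Dec (g ∣ f)
  ∣? g g≢0 f with divide g g≢0 f
  ... | division q r e small with zero? r
  ...   | yes z = yes (q , ≋-trans (mul-comm g q) (≋-sym (≋-trans e (add-zeroʳ z))))
  ...   | no r≢0 = no λ g∣f → ℕ.<⇒≱ small (∣-sz r≢0 (g∣r g∣f))
    where
    g∣r : g ∣ f → g ∣ r
    g∣r g∣f = ∣-resp ≋-refl (add-sub (≋-trans e (add-cong (mul-comm q g) ≋-refl))) (∣-sub g∣f (∣-factorˡ g q))

  deg-one : deg (1# ∷ []) ≡ 0
  deg-one = deg-Lead one-Lead

  one-nonzero : ¬ Zero (1# ∷ [])
  one-nonzero z = 0≢1 (sym (get z 0))

  ∣-one : ∀ {g} → g ∣ (1# ∷ []) → deg g ≡ 0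
  ∣-one {g} d = ℕ.n≤0⇒n≡0 (subst (deg g ≤_) deg-one (proj₂ (∣-deg one-nonzero d)))

  const-cancel : ∀ {c c⁻¹} → c * c⁻¹ ≡ 1# → ∀ f → mulP (c ∷ []) (scale c⁻¹ f) ≋ f
  const-cancel {c} {c⁻¹} cc⁻¹≡1 f = begin
    mulP (c ∷ []) (scale c⁻¹ f) ≈⟨ mul-constˡ c (scale c⁻¹ f) ⟩
    scale c (scale c⁻¹ f)       ≈⟨ scale-scale c c⁻¹ f ⟨
    scale (c * c⁻¹) f           ≈⟨ scale-cong cc⁻¹≡1 ≋-refl ⟩
    scale 1# f                  ≈⟨ scale-one f ⟩
    f                           ∎
    where open ≋-Reasoning

  unit-∣ : ∀ {r} → deg r ≡ 0 → ¬ Zero r → ∀ f → r ∣ f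
  unit-∣ {r} deg≡0 r≢0 f with leading-term r≢0
  ... | (n , c , t@(lead at c≢0 above)) with trans (sym (deg-Lead t)) deg≡0
  ...   | refl with inverse c c≢0
  ...     | c⁻¹ , cc⁻¹≡1 = scale c⁻¹ f , ≋-trans (mul-congˡ (scale c⁻¹ f) r≋c) (const-cancel cc⁻¹≡1 f)
    where
    r≋c : r ≋ (c ∷ [])
    r≋c = mk≋ λ { zero → at ; (suc i) → above (suc i) (s≤s z≤n) }

  unit-cancel : ∀ {g r b} → deg r ≡ 0 → ¬ Zero r → g ∣ mulP r b → g ∣ b
  unit-cancel {g} {r} {b} deg≡0 r≢0 g∣rb with unit-∣ deg≡0 r≢0 (1# ∷ [])
  ... | u , ru≋1 = ∣-resp ≋-refl rbu≋b (∣-mulʳ u g∣rb)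
    where
    rbu≋b : mulP (mulP r b) u ≋ b
    rbu≋b = begin
      mulP (mulP r b) u     ≈⟨ mul-exchange r b u ⟩
      mulP (mulP r u) b     ≈⟨ mul-congˡ b ru≋1 ⟩
      mulP (1# ∷ []) b      ≈⟨ mul-oneˡ b ⟩
      b                     ∎
      where open ≋-Reasoning

  Irreducible : Pol → Set
  Irreducible p = 1 ≤ deg p × (∀ h → h ∣ p → deg h ≡ 0 ⊎ deg h ≡ deg p)

  irreducible-nonconstant : ∀ {p} → Irreducible p → ¬ deg p ≡ 0
  irreducible-nonconstant (1≤deg , _) deg≡0 with subst (1 ≤_) deg≡0 1≤deg
  ... | ()

  irreducible-nonzero : ∀ {p} → Irreducible p → ¬ Zero p
  irreducible-nonzero irr = nonconstant-nonzero (proj₁ irr)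

  irreducible-∤one : ∀ {p} → Irreducible p → ¬ p ∣ (1# ∷ [])
  irreducible-∤one irr p∣1 = irreducible-nonconstant irr (∣-one p∣1)

  ∣-remainder : ∀ {g a b d q r} → g ∣ mulP a b → g ∣ mulP d b → a ≋ addP (mulP q d) r → g ∣ mulP r b
  ∣-remainder {g} {a} {b} {d} {q} {r} g∣ab g∣db a≋qd+r = ∣-resp ≋-refl rb≋ab-qdb (∣-sub g∣ab (∣-mulˡ q g∣db))
    where
    rb≋ab-qdb : subP (mulP a b) (mulP q (mulP d b)) ≋ mulP r b
    rb≋ab-qdb = begin
      subP (mulP a b) (mulP q (mulP d b))     ≈⟨ sub-cong ≋-refl (mul-assoc q d b) ⟨
      subP (mulP a b) (mulP (mulP q d) b)     ≈⟨ mul-subˡ b a (mulP q d) ⟨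
      mulP (subP a (mulP q d)) b              ≈⟨ mul-congˡ b (add-sub a≋qd+r) ⟩
      mulP r b                                ∎
      where open ≋-Reasoning

  -- Euclid's lemma for a factor r of smaller size than the irreducible p,
  -- by strong induction on sz r: divide p by r and pass to the remainder.
  euclid-small : ∀ {p} → Irreducible p → ∀ b r → sz r < sz p → ¬ p ∣ r → p ∣ mulP r b → p ∣ b
  euclid-small {p} irr@(_ , divisors) b r = <-rec P step (sz r) r refl
    where
    P : ℕ → Set
    P n = ∀ r → sz r ≡ n → sz r < sz p → ¬ p ∣ r → p ∣ mulP r b → p ∣ b
    step : ∀ n → (∀ {m} → m < n → P m) → P n
    step n ih r refl small p∤r p∣rb with zero? r
    ... | yes z = ⊥-elim (p∤r (∣-zero p z))
    ... | no r≢0 with deg r ℕ.≟ 0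
    ...   | yes deg≡0 = unit-cancel deg≡0 r≢0 p∣rb
    ...   | no deg≢0 with divide r r≢0 p
    ...     | division q r′ p≋qr+r′ r′-small with zero? r′
    ...       | yes z = ⊥-elim (divisor-degree (divisors r (q , r∣p)))
      where
      r∣p : mulP r q ≋ p
      r∣p = ≋-trans (mul-comm r q) (≋-sym (≋-trans p≋qr+r′ (add-zeroʳ z)))
      divisor-degree : deg r ≡ 0 ⊎ deg r ≡ deg p → ⊥
      divisor-degree (inj₁ deg≡0) = deg≢0 deg≡0
      divisor-degree (inj₂ deg≡) =
        ℕ.<-irrefl (trans (sz-deg r≢0) (trans (cong suc deg≡) (sym (sz-deg (irreducible-nonzero irr))))) small
    ...       | no r′≢0 = ih r′-small r′ refl (ℕ.<-trans r′-small small) p∤r′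
                   (∣-remainder {q = q} {r = r′} (∣-factorˡ p b) p∣rb p≋qr+r′)
      where
      p∤r′ : ¬ p ∣ r′
      p∤r′ p∣r′ = ℕ.<⇒≱ (ℕ.<-trans r′-small small) (∣-sz r′≢0 p∣r′)

  euclid : ∀ {p} → Irreducible p → ∀ a b → p ∣ mulP a b → p ∣ a ⊎ p ∣ b
  euclid {p} irr a b p∣ab with ∣? p (irreducible-nonzero irr) a
  ... | yes p∣a = inj₁ p∣a
  ... | no p∤a with divide p (irreducible-nonzero irr) a
  ...   | division q r a≋qp+r small =
    inj₂ (euclid-small irr b r small p∤r (∣-remainder {q = q} {r = r} p∣ab (∣-factorˡ p b) a≋qp+r))
    where
    p∤r : ¬ p ∣ r
    p∤r p∣r = p∤a (∣-resp ≋-refl (≋-sym a≋qp+r) (∣-add (∣-factorʳ p q) p∣r))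

  pow-nonzero : ∀ {p} k → ¬ Zero p → ¬ Zero (powP p k)
  pow-nonzero zero    p≢0 = one-nonzero
  pow-nonzero (suc k) p≢0 = mul-nonzero p≢0 (pow-nonzero k p≢0)

  pow-cong : ∀ {p q} k → p ≋ q → powP p k ≋ powP q k
  pow-cong zero    e = ≋-refl
  pow-cong (suc k) e = mul-cong e (pow-cong k e)

  pow-mul : ∀ x y k → powP (mulP x y) k ≋ mulP (powP x k) (powP y k)
  pow-mul x y zero    = ≋-sym (mul-oneˡ (1# ∷ []))
  pow-mul x y (suc k) = ≋-trans (mul-congʳ (mulP x y) (pow-mul x y k)) (mul-interchange x y (powP x k) (powP y k))

  pow-∣ : ∀ {g h} k → g ∣ h → powP g k ∣ powP h k
  pow-∣ zero    d = ∣-refl _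
  pow-∣ (suc k) d = ∣-mul d (pow-∣ k d)

  pow-∣-pow : ∀ p {j k} → j ≤ k → powP p j ∣ powP p k
  pow-∣-pow p {k = k}     z≤n       = one-∣ (powP p k)
  pow-∣-pow p {suc j} {suc k} (s≤s j≤k) = ∣-mul (∣-refl p) (pow-∣-pow p j≤k)

  square≋pow2 : ∀ p → mulP p p ≋ powP p 2
  square≋pow2 p = mul-congʳ p (≋-sym (mul-oneʳ p))

  euclid-pow : ∀ {p} → Irreducible p → ∀ k a → p ∣ powP a k → p ∣ a
  euclid-pow irr zero    a p∣1 = ⊥-elim (irreducible-∤one irr p∣1)
  euclid-pow irr (suc k) a p∣aᵏ⁺¹ with euclid irr a (powP a k) p∣aᵏ⁺¹
  ... | inj₁ p∣a  = p∣a
  ... | inj₂ p∣aᵏ = euclid-pow irr k a p∣aᵏ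

  ∤-pow-product : ∀ {p a b} → Irreducible p → ¬ p ∣ a → ¬ p ∣ b → ∀ i j → ¬ p ∣ mulP (powP a i) (powP b j)
  ∤-pow-product {a = a} {b} irr p∤a p∤b i j p∣ with euclid irr (powP a i) (powP b j) p∣
  ... | inj₁ p∣aⁱ = p∤a (euclid-pow irr i a p∣aⁱ)
  ... | inj₂ p∣bʲ = p∤b (euclid-pow irr j b p∣bʲ)

  cancel-coprime-factor : ∀ {p c} → Irreducible p → ¬ p ∣ c → ∀ k a → powP p k ∣ mulP a c → powP p k ∣ a
  cancel-coprime-factor irr p∤c zero a _ = one-∣ a
  cancel-coprime-factor {p} {c} irr p∤c (suc k) a pᵏ⁺¹∣ac
    with euclid irr a c (∣-trans (∣-factorˡ p (powP p k)) pᵏ⁺¹∣ac)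
  ... | inj₂ p∣c = ⊥-elim (p∤c p∣c)
  ... | inj₁ (a′ , pa′≋a) = ∣-resp ≋-refl pa′≋a (∣-mul (∣-refl p) (cancel-coprime-factor irr p∤c k a′ pᵏ∣a′c))
    where
    pᵏ∣a′c : powP p k ∣ mulP a′ c
    pᵏ∣a′c = ∣-cancelˡ (irreducible-nonzero irr)
               (∣-resp ≋-refl (≋-trans (mul-congˡ c (≋-sym pa′≋a)) (mul-assoc p a′ c)) pᵏ⁺¹∣ac)

  -- If p ∣ a and p^(m+1) ∣ a^m then p² ∣ a: writing a = p a′, p ∣ a′^m.
  square-∣-of-excess : ∀ {p} → Irreducible p → ∀ a → p ∣ a → ∀ m → powP p (suc m) ∣ powP a m → mulP p p ∣ a
  square-∣-of-excess {p} irr a (a′ , pa′≋a) m pᵐ⁺¹∣aᵐ = ∣-resp ≋-refl pa′≋a (∣-mul (∣-refl p) p∣a′)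
    where
    pᵐp∣pᵐa′ᵐ : mulP (powP p m) p ∣ mulP (powP p m) (powP a′ m)
    pᵐp∣pᵐa′ᵐ = ∣-resp (mul-comm p (powP p m)) (≋-trans (pow-cong m (≋-sym pa′≋a)) (pow-mul p a′ m)) pᵐ⁺¹∣aᵐ
    p∣a′ : p ∣ a′
    p∣a′ = euclid-pow irr m a′ (∣-cancelˡ (pow-nonzero m (irreducible-nonzero irr)) pᵐp∣pᵐa′ᵐ)

  -- Finiteness: `polys n` lists every coefficient list of length ≤ n, so
  -- every divisor of g is represented (via `strip`) in `polys (sz g)`.
  polys : ℕ → List Pol
  polys zero    = [] ∷ []
  polys (suc n) = [] ∷ cartesianProductWith _∷_ elements (polys n)

  polys-complete : ∀ n l → length l ≤ n → l ∈ polys n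
  polys-complete zero    []      _         = here refl
  polys-complete (suc n) []      _         = here refl
  polys-complete (suc n) (a ∷ l) (s≤s len) = there (∈-cartesianProductWith⁺ _∷_ (complete a) (polys-complete n l len))

  divisor-listed : ∀ {h g} → ¬ Zero g → h ∣ g → strip h ∈ polys (sz g)
  divisor-listed g≢0 h∣g = polys-complete _ _ (∣-sz g≢0 h∣g)

  ∣-strip : ∀ {h g} → h ∣ g → strip h ∣ g
  ∣-strip {h} = ∣-resp (≋-sym (strip-≋ h)) ≋-refl

  deg-strip : ∀ h → deg (strip h) ≡ deg h
  deg-strip h = deg-≋ (strip-≋ h)

  -- Every nonconstant polynomial has an irreducible factor: by strong
  -- induction on the degree, either g has a proper nonconstant divisor
  -- (found by searching `polys`) or g is itself irreducible.
  ProperDivisor : Pol → Pol → Set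
  ProperDivisor g h = 1 ≤ deg h × deg h < deg g × h ∣ g

  proper-divisor? : ∀ g h → Dec (ProperDivisor g h)
  proper-divisor? g h with 1 ℕ.≤? deg h | deg h ℕ.<? deg g
  ... | no ¬1≤deg | _ = no λ d → ¬1≤deg (proj₁ d)
  ... | yes _ | no ¬< = no λ d → ¬< (proj₁ (proj₂ d))
  ... | yes 1≤deg | yes < with ∣? h (nonconstant-nonzero 1≤deg) g
  ...   | yes h∣g = yes (1≤deg , < , h∣g)
  ...   | no ¬h∣g = no λ d → ¬h∣g (proj₂ (proj₂ d))

  irreducible-factor : ∀ g → 1 ≤ deg g → Σ Pol λ p → Irreducible p × p ∣ g
  irreducible-factor g₀ = <-rec P step (deg g₀) g₀ refl
    where
    P : ℕ → Set
    P n = ∀ g → deg g ≡ n → 1 ≤ deg g → Σ Pol λ p → Irreducible p × p ∣ g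
    step : ∀ n → (∀ {m} → m < n → P m) → P n
    step n ih g refl 1≤deg with any? (proper-divisor? g) (polys (sz g))
    ... | yes found with find found
    ...   | h , _ , (1≤deg-h , h<g , h∣g) with ih h<g h refl 1≤deg-h
    ...     | p , irr , p∣h = p , irr , ∣-trans p∣h h∣g
    step n ih g refl 1≤deg | no none = g , (1≤deg , only-trivial) , ∣-refl g
      where
      only-trivial : ∀ h → h ∣ g → deg h ≡ 0 ⊎ deg h ≡ deg g
      only-trivial h h∣g with deg h ℕ.≟ 0 | deg h ℕ.≟ deg g
      ... | yes d≡0 | _       = inj₁ d≡0
      ... | no _    | yes d≡g = inj₂ d≡g
      ... | no d≢0  | no d≢g  = ⊥-elim (none (lose (divisor-listed (nonconstant-nonzero 1≤deg) h∣g) proper))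
        where
        proper : ProperDivisor g (strip h)
        proper = subst (1 ≤_) (sym (deg-strip h)) (ℕ.n≢0⇒n>0 d≢0)
               , subst (_< deg g) (sym (deg-strip h)) (ℕ.≤∧≢⇒< (proj₂ (∣-deg (nonconstant-nonzero 1≤deg) h∣g)) d≢g)
               , ∣-strip h∣g

  monic-associate : ∀ {t} → ¬ Zero t → Σ Pol λ t′ → Monic t′ × t′ ∣ t × deg t′ ≡ deg t
  monic-associate {t} t≢0 with leading-term t≢0
  ... | (n , c , lt) with inverse c (Lead.≢0 lt)
  ...   | c⁻¹ , cc⁻¹≡1 = t′ , Lead⇒Monic {t′} lt′ , t′∣t , trans (deg-Lead lt′) (sym (deg-Lead lt))
    where
    t′ = scale c⁻¹ t
    lt′ : Lead t′ n 1#
    lt′ = subst (Lead t′ n) (trans (*-comm c⁻¹ c) cc⁻¹≡1) (Lead-scale c⁻¹ (inverse-nonzero cc⁻¹≡1) lt)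
    t′∣t : t′ ∣ t
    t′∣t = (c ∷ []) , ≋-trans (mul-comm t′ (c ∷ [])) (const-cancel cc⁻¹≡1 t)

  CommonDivisor : Pol → Pol → Pol → Set
  CommonDivisor g₁ g₂ h = h ∣ g₁ × h ∣ g₂

  common-divisor? : ∀ {g₁} g₂ → ¬ Zero g₁ → ∀ h → Dec (CommonDivisor g₁ g₂ h)
  common-divisor? {g₁} g₂ g₁≢0 h with zero? h
  ... | yes z = no λ d → g₁≢0 (≋-trans (≋-sym (_∣_.eqn (proj₁ d))) (mul-zeroˡ _ z))
  ... | no h≢0 with ∣? h h≢0 g₁ | ∣? h h≢0 g₂
  ...   | yes h∣g₁ | yes h∣g₂ = yes (h∣g₁ , h∣g₂)
  ...   | no ¬h∣g₁ | _        = no λ d → ¬h∣g₁ (proj₁ d)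
  ...   | yes _    | no ¬h∣g₂ = no λ d → ¬h∣g₂ (proj₂ d)

  maximal-common-divisor : ∀ {g₁} g₂ → ¬ Zero g₁ →
    Σ Pol λ t → CommonDivisor g₁ g₂ t × (∀ h → CommonDivisor g₁ g₂ h → deg h ≤ deg t)
  maximal-common-divisor {g₁} g₂ g₁≢0 = best , holds , maximal
    where
    open Maximum (maximum deg (common-divisor? g₂ g₁≢0) (polys (sz g₁)) (1# ∷ []) (one-∣ g₁ , one-∣ g₂))
    maximal : ∀ h → CommonDivisor g₁ g₂ h → deg h ≤ deg best
    maximal h (h∣g₁ , h∣g₂) = subst (_≤ deg best) (deg-strip h)
      (≥listed (strip h) (divisor-listed g₁≢0 h∣g₁) (∣-strip h∣g₁ , ∣-strip h∣g₂))

  record CoprimeSplitting (g₁ g₂ : Pol) : Set where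
    field
      common  : Pol
      monic   : Monic common
      cofactor₁ cofactor₂ : Pol
      eqn₁    : mulP common cofactor₁ ≋ g₁
      eqn₂    : mulP common cofactor₂ ≋ g₂
      coprime : ∀ h → h ∣ cofactor₁ → h ∣ cofactor₂ → deg h ≡ 0

  coprime-splitting : ∀ {g₁} g₂ → ¬ Zero g₁ → CoprimeSplitting g₁ g₂
  coprime-splitting {g₁} g₂ g₁≢0 with maximal-common-divisor g₂ g₁≢0
  ... | t₀ , (t₀∣g₁ , t₀∣g₂) , maximal with monic-associate (proj₁ (∣-deg g₁≢0 t₀∣g₁))
  ...   | t , monic , t∣t₀ , deg-t≡ with ∣-trans t∣t₀ t₀∣g₁ | ∣-trans t∣t₀ t₀∣g₂
  ...     | (f₁ , tf₁≋g₁) | (f₂ , tf₂≋g₂) = record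
    { common = t ; monic = monic ; cofactor₁ = f₁ ; cofactor₂ = f₂
    ; eqn₁ = tf₁≋g₁ ; eqn₂ = tf₂≋g₂ ; coprime = coprime }
    where
    t≢0 : ¬ Zero t
    t≢0 = Monic-nonzero {t} monic
    -- a common divisor h of f₁, f₂ gives the common divisor h t of g₁, g₂
    coprime : ∀ h → h ∣ f₁ → h ∣ f₂ → deg h ≡ 0
    coprime h h∣f₁ h∣f₂ = ℕ.n≤0⇒n≡0 (ℕ.+-cancelʳ-≤ (deg t) (deg h) 0 (begin
      deg h +ℕ deg t   ≡⟨ deg-mul h≢0 t≢0 ⟨
      deg (mulP h t)   ≤⟨ maximal (mulP h t) (lift tf₁≋g₁ h∣f₁ , lift tf₂≋g₂ h∣f₂) ⟩
      deg t₀           ≡⟨ deg-t≡ ⟨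
      deg t            ∎))
      where
      open ℕ.≤-Reasoning
      h≢0 : ¬ Zero h
      h≢0 = proj₁ (∣-deg (proj₁ (proj₂ (∣-degrees {t} g₁≢0 (f₁ , tf₁≋g₁)))) h∣f₁)
      lift : ∀ {f g} → mulP t f ≋ g → h ∣ f → mulP h t ∣ g
      lift {f} tf≋g h∣f = ∣-resp ≋-refl (≋-trans (mul-comm f t) tf≋g) (∣-mul h∣f (∣-refl t))

  SquareFree′ : Pol → Set
  SquareFree′ s = ∀ g → mulP g g ∣ s → deg g ≡ 0

  Coprime′ : Pol → Pol → Set
  Coprime′ a b = ∀ h → h ∣ a → h ∣ b → deg h ≡ 0

  squareFree⇒′ : ∀ {s} → SquareFree s → SquareFree′ s
  squareFree⇒′ sf g gg∣s = sf g (∣⇒∣ₚ (∣-resp (square≋pow2 g) ≋-refl gg∣s))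

  squareFree⇐′ : ∀ {s} → SquareFree′ s → SquareFree s
  squareFree⇐′ sf g g²∣s = sf g (∣-resp (≋-sym (square≋pow2 g)) ≋-refl (∣ₚ⇒∣ g²∣s))

  coprime⇒′ : ∀ {a b} → Coprime a b → Coprime′ a b
  coprime⇒′ c h h∣a h∣b = c h (∣⇒∣ₚ h∣a) (∣⇒∣ₚ h∣b)

  coprime⇐′ : ∀ {a b} → Coprime′ a b → Coprime a b
  coprime⇐′ c h h∣a h∣b = c h (∣ₚ⇒∣ h∣a) (∣ₚ⇒∣ h∣b)

  constant-if-no-irreducible-factor : ∀ g → (∀ p → Irreducible p → p ∣ g → ⊥) → deg g ≡ 0
  constant-if-no-irreducible-factor g none with deg g ℕ.≟ 0
  ... | yes deg≡0 = deg≡0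
  ... | no deg≢0 with irreducible-factor g (ℕ.n≢0⇒n>0 deg≢0)
  ...   | p , irr , p∣g = ⊥-elim (none p irr p∣g)

  coprime-apart : ∀ {p a b} → Irreducible p → Coprime′ a b → p ∣ a → ¬ p ∣ b
  coprime-apart {p} irr c p∣a p∣b = irreducible-nonconstant irr (c p p∣a p∣b)

  squareFree-∤-square : ∀ {p a} → Irreducible p → SquareFree′ a → ¬ mulP p p ∣ a
  squareFree-∤-square {p} irr sf pp∣a = irreducible-nonconstant irr (sf p pp∣a)

  squareFree-divisor : ∀ {a g} → SquareFree′ g → a ∣ g → SquareFree′ a
  squareFree-divisor sf a∣g h hh∣a = sf h (∣-trans hh∣a a∣g)

  squareFree-coprime-factors : ∀ {a b} → SquareFree′ (mulP a b) → Coprime′ a b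
  squareFree-coprime-factors sf h h∣a h∣b = sf h (∣-mul h∣a h∣b)

  -- The product of coprime square-free polynomials is square-free: an
  -- irreducible p with p² ∣ a b divides, say, a but not b, so p² ∣ a.
  squareFree-mul : ∀ {a b} → SquareFree′ a → SquareFree′ b → Coprime′ a b → SquareFree′ (mulP a b)
  squareFree-mul {a} {b} sf-a sf-b c h hh∣ab = constant-if-no-irreducible-factor h no-factor
    where
    no-factor : ∀ p → Irreducible p → p ∣ h → ⊥
    no-factor p irr p∣h = split (euclid irr a b (∣-trans (∣-factorˡ p p) pp∣ab))
      where
      pp∣ab : mulP p p ∣ mulP a b
      pp∣ab = ∣-trans (∣-mul p∣h p∣h) hh∣ab
      square-in : ∀ {x y} → SquareFree′ x → ¬ p ∣ y → mulP p p ∣ mulP x y → ⊥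
      square-in {x} sf-x p∤y pp∣xy = squareFree-∤-square irr sf-x (∣-resp (≋-sym (square≋pow2 p)) ≋-refl
        (cancel-coprime-factor irr p∤y 2 x (∣-resp (square≋pow2 p) ≋-refl pp∣xy)))
      split : p ∣ a ⊎ p ∣ b → ⊥
      split (inj₁ p∣a) = square-in sf-a (coprime-apart irr c p∣a) pp∣ab
      split (inj₂ p∣b) = square-in sf-b (λ p∣a → coprime-apart irr c p∣a p∣b) (∣-resp ≋-refl (mul-comm a b) pp∣ab)

  excess-multiplicity : ∀ {p a c} → Irreducible p → SquareFree′ a → ¬ p ∣ c →
                        ∀ k → ¬ powP p (suc k) ∣ mulP (powP a k) c
  excess-multiplicity {p} {a} irr sf p∤c k pᵏ⁺¹∣aᵏc =
    squareFree-∤-square irr sf (square-∣-of-excess irr a p∣a k pᵏ⁺¹∣aᵏ)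
    where
    pᵏ⁺¹∣aᵏ : powP p (suc k) ∣ powP a k
    pᵏ⁺¹∣aᵏ = cancel-coprime-factor irr p∤c (suc k) (powP a k) pᵏ⁺¹∣aᵏc
    p∣a : p ∣ a
    p∣a = euclid-pow irr k a (∣-trans (∣-factorˡ p (powP p k)) pᵏ⁺¹∣aᵏ)

  no-fourth-power : ∀ {p a c f} → Irreducible p → SquareFree′ a → ¬ p ∣ c → ∀ k → k ≤ 3 →
                    f ≋ mulP (powP a k) c → ¬ powP p 4 ∣ f
  no-fourth-power {p} irr sf p∤c k k≤3 f≋aᵏc p⁴∣f =
    excess-multiplicity irr sf p∤c k (∣-trans (pow-∣-pow p (s≤s k≤3)) (∣-resp ≋-refl f≋aᵏc p⁴∣f))

  -- (ii) ⇒ (i): f₁ f₂² f₃³ with square-free, pairwise coprime fᵢ is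
  -- 4th-power-free, since an irreducible p divides exactly one fᵢ.
  fourth-power-free : ∀ {f₁ f₂ f₃} → SquareFree′ f₁ → SquareFree′ f₂ → SquareFree′ f₃ →
                      Coprime′ f₁ f₂ → Coprime′ f₁ f₃ → Coprime′ f₂ f₃ →
                      ∀ g → powP g 4 ∣ mulP f₁ (mulP (powP f₂ 2) (powP f₃ 3)) → deg g ≡ 0
  fourth-power-free {f₁} {f₂} {f₃} sf₁ sf₂ sf₃ c₁₂ c₁₃ c₂₃ g g⁴∣f = constant-if-no-irreducible-factor g no-factor
    where
    no-factor : ∀ p → Irreducible p → p ∣ g → ⊥
    no-factor p irr p∣g = in-factor (euclid irr f₁ _ (∣-trans (∣-factorˡ p (powP p 3)) p⁴∣f))
      where
      p⁴∣f : powP p 4 ∣ mulP f₁ (mulP (powP f₂ 2) (powP f₃ 3))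
      p⁴∣f = ∣-trans (pow-∣ 4 p∣g) g⁴∣f
      apart : ∀ {a b} → Coprime′ a b → p ∣ a → ¬ p ∣ b
      apart = coprime-apart irr
      in-factor : p ∣ f₁ ⊎ p ∣ mulP (powP f₂ 2) (powP f₃ 3) → ⊥
      in-factor (inj₁ p∣f₁) =
        no-fourth-power irr sf₁ (∤-pow-product irr (apart c₁₂ p∣f₁) (apart c₁₃ p∣f₁) 2 3) 1 (s≤s z≤n)
          (front₁ f₁ f₂ f₃) p⁴∣f
      in-factor (inj₂ p∣f₂²f₃³) with euclid irr (powP f₂ 2) (powP f₃ 3) p∣f₂²f₃³
      ... | inj₁ p∣f₂² = let p∣f₂ = euclid-pow irr 2 f₂ p∣f₂² in
        no-fourth-power irr sf₂ (∤-pow-product irr (λ p∣f₁ → apart c₁₂ p∣f₁ p∣f₂) (apart c₂₃ p∣f₂) 1 3) 2 (s≤s (s≤s z≤n))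
          (front₂ f₁ f₂ f₃) p⁴∣f
      ... | inj₂ p∣f₃³ = let p∣f₃ = euclid-pow irr 3 f₃ p∣f₃³ in
        no-fourth-power irr sf₃ (∤-pow-product irr (λ p∣f₁ → apart c₁₃ p∣f₁ p∣f₃) (λ p∣f₂ → apart c₂₃ p∣f₂ p∣f₃) 1 2) 3 ℕ.≤-refl
          (front₃ f₁ f₂ f₃) p⁴∣f

  module _ (N d : ℕ) (f : Pol) where

    decomp⇒inF : Decomp N d f → InF N d f
    decomp⇒inF dc@(f₁ , f₂ , f₃ , m₁ , m₂ , m₃ , sf₁ , sf₂ , sf₃ , c₁₂ , c₁₃ , c₂₃ , _ , f≈) =
      Monic-≋ {P} (≋-sym f≋P) monic-P , fourth-power-free-f , dc
      where
      P = mulP f₁ (mulP (powP f₂ 2) (powP f₃ 3))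
      f≋P : f ≋ P
      f≋P = ≈ₚ⇒≋ {f} f≈
      monic-P : Monic P
      monic-P = Monic-mul {f₁} m₁ (Monic-mul {powP f₂ 2} (Monic-pow {f₂} 2 m₂) (Monic-pow {f₃} 3 m₃))
      fourth-power-free-f : FourthPowerFree f
      fourth-power-free-f g g⁴∣f =
        fourth-power-free (squareFree⇒′ {f₁} sf₁) (squareFree⇒′ {f₂} sf₂) (squareFree⇒′ {f₃} sf₃)
          (coprime⇒′ {f₁} {f₂} c₁₂) (coprime⇒′ {f₁} {f₃} c₁₃) (coprime⇒′ {f₂} {f₃} c₂₃)
          g (∣-resp ≋-refl f≋P (∣ₚ⇒∣ g⁴∣f))

    decomp⇒twoFactor : Decomp N d f → TwoFactor N d f
    decomp⇒twoFactor (f₁ , f₂ , f₃ , m₁ , m₂ , m₃ , sf₁ , sf₂ , sf₃ , c₁₂ , c₁₃ , c₂₃ , deg≡ , f≈) =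
      mulP f₁ f₃ , mulP f₂ f₃ , Monic-mul {f₁} m₁ m₃ , Monic-mul {f₂} m₂ m₃ ,
      squareFree⇐′ {mulP f₁ f₃} (squareFree-mul (squareFree⇒′ {f₁} sf₁) sf₃′ (coprime⇒′ {f₁} {f₃} c₁₃)) ,
      squareFree⇐′ {mulP f₂ f₃} (squareFree-mul (squareFree⇒′ {f₂} sf₂) sf₃′ (coprime⇒′ {f₂} {f₃} c₂₃)) ,
      weighted-degree ,
      ≋⇒≈ₚ {f} (≋-trans (≈ₚ⇒≋ {f} f≈) (merge-cube f₁ f₂ f₃))
      where
      sf₃′ = squareFree⇒′ {f₃} sf₃
      n₃ = Monic-nonzero {f₃} m₃
      weighted-degree : deg (mulP f₁ f₃) +ℕ N *ℕ deg (mulP f₂ f₃) ≡ d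
      weighted-degree = begin
        deg (mulP f₁ f₃) +ℕ N *ℕ deg (mulP f₂ f₃)
          ≡⟨ cong₂ (λ x y → x +ℕ N *ℕ y) (deg-mul (Monic-nonzero {f₁} m₁) n₃) (deg-mul (Monic-nonzero {f₂} m₂) n₃) ⟩
        (deg f₁ +ℕ deg f₃) +ℕ N *ℕ (deg f₂ +ℕ deg f₃)
          ≡⟨ weighted-degree-merge (deg f₁) (deg f₂) (deg f₃) N ⟩
        deg f₁ +ℕ N *ℕ deg f₂ +ℕ suc N *ℕ deg f₃
          ≡⟨ deg≡ ⟩
        d ∎
        where open ≡-Reasoning

    twoFactor⇒decomp : TwoFactor N d f → Decomp N d f
    twoFactor⇒decomp (g₁ , g₂ , mg₁ , mg₂ , sg₁ , sg₂ , deg≡ , f≈) =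
      f₁ , f₂ , t ,
      Monic-cofactor {t} {f₁} {g₁} monic mg₁ eqn₁ , Monic-cofactor {t} {f₂} {g₂} monic mg₂ eqn₂ , monic ,
      squareFree⇐′ {f₁} (squareFree-divisor sf-f₁t (∣-factorˡ f₁ t)) ,
      squareFree⇐′ {f₂} (squareFree-divisor sf-f₂t (∣-factorˡ f₂ t)) ,
      squareFree⇐′ {t} (squareFree-divisor sf-f₁t (∣-factorʳ t f₁)) ,
      coprime⇐′ {f₁} {f₂} coprime ,
      coprime⇐′ {f₁} {t} (squareFree-coprime-factors sf-f₁t) ,
      coprime⇐′ {f₂} {t} (squareFree-coprime-factors sf-f₂t) ,
      weighted-degree ,
      ≋⇒≈ₚ {f} (≋-trans (≈ₚ⇒≋ {f} f≈) (≋-trans (mul-cong (≋-sym eqn₁) (pow-cong 2 (≋-sym eqn₂))) (split-cube t f₁ f₂)))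
      where
      open CoprimeSplitting (coprime-splitting g₂ (Monic-nonzero {g₁} mg₁))
        renaming (common to t; cofactor₁ to f₁; cofactor₂ to f₂)
      -- fᵢ t ≋ gᵢ is square-free, so fᵢ and t are square-free and coprime
      sf-f₁t : SquareFree′ (mulP f₁ t)
      sf-f₁t = squareFree-divisor (squareFree⇒′ {g₁} sg₁) (∣-resp ≋-refl (≋-trans (mul-comm f₁ t) eqn₁) (∣-refl _))
      sf-f₂t : SquareFree′ (mulP f₂ t)
      sf-f₂t = squareFree-divisor (squareFree⇒′ {g₂} sg₂) (∣-resp ≋-refl (≋-trans (mul-comm f₂ t) eqn₂) (∣-refl _))
      deg-g : ∀ {g c} → Monic g → mulP t c ≋ g → deg g ≡ deg t +ℕ deg c
      deg-g {g} {c} mg e = proj₂ (proj₂ (∣-degrees {t} {g} (Monic-nonzero {g} mg) (c , e)))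
      weighted-degree : deg f₁ +ℕ N *ℕ deg f₂ +ℕ suc N *ℕ deg t ≡ d
      weighted-degree = begin
        deg f₁ +ℕ N *ℕ deg f₂ +ℕ suc N *ℕ deg t
          ≡⟨ weighted-degree-merge (deg f₁) (deg f₂) (deg t) N ⟨
        (deg f₁ +ℕ deg t) +ℕ N *ℕ (deg f₂ +ℕ deg t)
          ≡⟨ cong₂ (λ x y → x +ℕ N *ℕ y) (ℕ.+-comm (deg f₁) (deg t)) (ℕ.+-comm (deg f₂) (deg t)) ⟩
        (deg t +ℕ deg f₁) +ℕ N *ℕ (deg t +ℕ deg f₂)
          ≡⟨ cong₂ (λ x y → x +ℕ N *ℕ y) (deg-g mg₁ eqn₁) (deg-g mg₂ eqn₂) ⟨
        deg g₁ +ℕ N *ℕ deg g₂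
          ≡⟨ deg≡ ⟩
        d ∎
        where open ≡-Reasoning

lemma4p4 : (F : FiniteField) (N d : ℕ) → 2 ≤ N →
    let open Poly F in
    (f : Pol) → (InF N d f ⇔ Decomp N d f) × (Decomp N d f ⇔ TwoFactor N d f)
lemma4p4 F N d _ f =
    mk⇔ (λ { (_ , _ , decomposition) → decomposition }) (decomp⇒inF N d f)
  , mk⇔ (decomp⇒twoFactor N d f) (twoFactor⇒decomp N d f)
  where open Polynomials F
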